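{- For $[\mathsf{K}_\mathtt{wh}]\in\{[\mathsf{tB}^\mathtt{MS}_\mathtt{FS}],[\mathsf{K}^\mathtt{MS}_\mathtt{FS}]\}$, let $\mathtt{MONO}$ be the rule: from $\vdash\phi\to\psi$ infer $\vdash[\mathsf{K}_\mathtt{wh}]^x\phi\to[\mathsf{K}_\mathtt{wh}]^x\psi$. Then $\mathbf{S4.2}_\approx^{[\mathsf{tB}^\mathtt{MS}_\mathtt{FS}]}\oplus\mathtt{MONO}=\mathbf{S4.2}_\approx^{[\mathsf{tB}^\mathtt{MS}_\mathtt{FS}]}\oplus\big(\neg(x\approx y)\to([\mathsf{B}]\phi\to\phi)\big)$ and $\mathbf{S4.2}_\approx^{[\mathsf{K}^\mathtt{MS}_\mathtt{FS}]}\oplus\mathtt{MONO}=\mathbf{S4.2}_\approx^{[\mathsf{K}^\mathtt{MS}_\mathtt{FS}]}\oplus\big(\neg(x\approx y)\to([\mathsf{B}]\phi\to\phi)\big)$, where $\mathbf{L}\oplus\mathtt{MONO}$ is the least set of formulas containing the axioms of $\mathbf{L}$ and closed under the rules of $\mathbf{L}$ and $\mathtt{MONO}$, and $\mathbf{L}\oplus\chi$ is the least set containing the axioms of $\mathbf{L}$ and all instances of the schema $\chi$ and closed under the rules of $\mathbf{L}$.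
   Context: Fix a set $\mathcal{P}$ of predicate symbols with arities and a countably infinite set $\mathbf{X}$ of variables. For $[\mathsf{K}_\mathtt{wh}]\in\{[\mathsf{tB}^\mathtt{MS}_\mathtt{FS}],[\mathsf{K}^\mathtt{MS}_\mathtt{FS}]\}$, the language $\mathcal{L}_\approx([\mathsf{K}_\mathtt{wh}])$ is $\phi ::= P(y_1,\dots,y_n)\mid x\approx y\mid\neg\phi\mid\phi\wedge\phi\mid[\mathsf{K}]\phi\mid[\mathsf{K}_\mathtt{wh}]^x\phi$, where $[\mathsf{K}_\mathtt{wh}]^x$ binds $x$. Abbreviations: $\langle\mathsf{K}\rangle\phi:=\neg[\mathsf{K}]\neg\phi$, $[\mathsf{B}]\phi:=\langle\mathsf{K}\rangle[\mathsf{K}]\phi$. $FV(\phi)$: free variables; $\phi[y/x]$: replace free $x$ by $y$, with $y$ admissible. Schemas range over all formulas and variables. Proof systems. $\mathbf{S4.2}^{[\mathsf{K}]}$: all instances of propositional tautologies and of $[\mathsf{K}](\phi\to\psi)\to([\mathsf{K}]\phi\to[\mathsf{K}]\psi)$, $[\mathsf{K}]\phi\to\phi$, $[\mathsf{K}]\phi\to[\mathsf{K}][\mathsf{K}]\phi$, $\langle\mathsf{K}\rangle[\mathsf{K}]\phi\to[\mathsf{K}]\langle\mathsf{K}\rangle\phi$, with modus ponens and necessitation for $[\mathsf{K}]$. Axiom schemas: $\mathtt{K_{wh}toFS}$: $[\mathsf{K}_\mathtt{wh}]^x\phi\to([\mathsf{B}]\phi\to\phi)[y/x]$; $\mathtt{BtoBK_{wh}}$: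 $[\mathsf{B}]\phi[y/x]\to[\mathsf{B}][\mathsf{K}_\mathtt{wh}]^x\phi$. Rules (any $n\ge0$, formulas $\psi_0..\psi_n$ with $x\notin\bigcup_i FV(\psi_i)$; $C[\chi]$ denotes $\psi_0\to[\mathsf{K}](\psi_1\to\cdots[\mathsf{K}](\psi_n\to\chi)\cdots)$): $\mathtt{K_{wh}toTB}$: from $\vdash C[\neg([\mathsf{B}]\phi\wedge\phi)]$ infer $\vdash C[\neg[\mathsf{K}_\mathtt{wh}]^x\phi]$; $\mathtt{K_{wh}toK}$: from $\vdash C[\neg[\mathsf{K}]\phi]$ infer $\vdash C[\neg[\mathsf{K}_\mathtt{wh}]^x\phi]$; $\mathtt{FS\&BtoK_{wh}}$: from $\vdash C[[\mathsf{B}]\phi\to\phi]$ infer $\vdash C[[\mathsf{B}]\phi[y/x]\to[\mathsf{K}_\mathtt{wh}]^x\phi]$; $\mathtt{FS\&KtoK_{wh}}$: from $\vdash C[[\mathsf{B}]\phi\to\phi]$ infer $\vdash C[[\mathsf{K}]\phi[y/x]\to[\mathsf{K}_\mathtt{wh}]^x\phi]$. Logics: $\mathbf{S4.2}^{[\mathsf{tB}^\mathtt{MS}_\mathtt{FS}]}=\mathbf{S4.2}^{[\mathsf{K}]}+\mathtt{K_{wh}toFS},\mathtt{BtoBK_{wh}},\mathtt{K_{wh}toTB},\mathtt{FS\&BtoK_{wh}}$; $\mathbf{S4.2}^{[\mathsf{K}^\mathtt{MS}_\mathtt{FS}]}=\mathbf{S4.2}^{[\mathsf{K}]}+\mathtt{K_{wh}toFS},\mathtt{BtoBK_{wh}},\mathtt{K_{wh}toK},\mathtt{FS\&KtoK_{wh}}$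 (with $[\mathsf{K}_\mathtt{wh}]$ instantiated accordingly). $\mathbf{S4.2}_\approx^{[\mathsf{K}_\mathtt{wh}]}$ is $\mathbf{S4.2}^{[\mathsf{K}_\mathtt{wh}]}$ over $\mathcal{L}_\approx([\mathsf{K}_\mathtt{wh}])$ plus the axioms $x\approx x$, $x\approx y\to(\phi[x/z]\to\phi[y/z])$, $\neg(x\approx y)\to[\mathsf{K}]\neg(x\approx y)$. -}

module Defs where

open import Data.Nat using (ℕ; _≟_)
open import Data.Bool using (Bool; true; false; not; _∧_)
open import Data.Vec using (Vec; map)
open import Data.Vec.Membership.Propositional using (_∈_)
open import Data.List using (List; []; _∷_)
open import Data.List.Relation.Unary.All using (All)
open import Data.Product using (_×_)
open import Data.Sum using (_⊎_)
open import Data.Unit using (⊤)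
open import Relation.Nullary using (¬_; yes; no)
open import Relation.Binary.PropositionalEquality using (_≡_; _≢_)

Var : Set
Var = ℕ

record Sig : Set₁ where
  field
    Pred  : Set
    arity : Pred → ℕ
open Sig public

data Which : Set where
  tB K : Which

-- Which extension of the base logic S4.2_≈^{[K_wh]}:
--   base : the logic itself
--   mono : ⊕ MONO (the rule)
--   fsAx : ⊕ (¬(x ≈ y) → ([B]φ → φ))  (the schema)
data Ext : Set where
  base mono fsAx : Ext

module _ (S : Sig) where

  -- The language L_≈([K_wh]); 'kwh x φ' is [K_wh]^x φ (binds x).
  infix  7 _≈_
  infixr 6 ~_ □_
  infixr 5 _&_
  data Form : Set where
    atom : (P : Pred S) → Vec Var (arity S P) → Form
    _≈_  : Var → Var → Form
    ~_   : Form → Form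
    _&_  : Form → Form → Form
    □_   : Form → Form
    kwh  : Var → Form → Form

module _ {S : Sig} where

  infixr 4 _⇒_
  infixr 6 ◇_ B_

  _⇒_ : Form S → Form S → Form S
  φ ⇒ ψ = ~ (φ & ~ ψ)

  ◇_ : Form S → Form S
  ◇ φ = ~ (□ (~ φ))

  B_ : Form S → Form S
  B φ = ◇ (□ φ)

  data Free (x : Var) : Form S → Set where
    f-atom : ∀ {P ys} → x ∈ ys → Free x (atom P ys)
    f-eql  : ∀ {u v} → (x ≡ u ⊎ x ≡ v) → Free x (u ≈ v)
    f-neg  : ∀ {φ} → Free x φ → Free x (~ φ)
    f-andl : ∀ {φ ψ} → Free x φ → Free x (φ & ψ)
    f-andr : ∀ {φ ψ} → Free x ψ → Free x (φ & ψ)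
    f-box  : ∀ {φ} → Free x φ → Free x (□ φ)
    f-kwh  : ∀ {z φ} → x ≢ z → Free x φ → Free x (kwh z φ)

  rn : Var → Var → Var → Var
  rn x y v with v ≟ x
  ... | yes _ = y
  ... | no  _ = v

  -- sub x y φ  is  φ[y/x]: replace the free occurrences of x by y
  sub : Var → Var → Form S → Form S
  sub x y (atom P ys) = atom P (map (rn x y) ys)
  sub x y (u ≈ v)     = rn x y u ≈ rn x y v
  sub x y (~ φ)       = ~ sub x y φ
  sub x y (φ & ψ)     = sub x y φ & sub x y ψ
  sub x y (□ φ)       = □ sub x y φ
  sub x y (kwh z φ) with z ≟ x
  ... | yes _ = kwh z φ
  ... | no  _ = kwh z (sub x y φ)

  -- Adm y x φ : y is admissible (free) for x in φ, i.e. no free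
  -- occurrence of x in φ lies in the scope of a binder [K_wh]^y.
  Adm : Var → Var → Form S → Set
  Adm y x (atom P ys) = ⊤
  Adm y x (u ≈ v)     = ⊤
  Adm y x (~ φ)       = Adm y x φ
  Adm y x (φ & ψ)     = Adm y x φ × Adm y x ψ
  Adm y x (□ φ)       = Adm y x φ
  Adm y x (kwh z φ)   = (¬ Free x (kwh z φ)) ⊎ (z ≢ y × Adm y x φ)

  -- propositional evaluation: ¬ and ∧ are interpreted, every other
  -- formula (atoms, ≈, [K], [K_wh]) is a propositional letter.
  eval : (Form S → Bool) → Form S → Bool
  eval v (~ φ)   = not (eval v φ)
  eval v (φ & ψ) = eval v φ ∧ eval v ψ
  eval v φ       = v φ

  Taut : Form S → Set
  Taut φ = ∀ (v : Form S → Bool) → eval v φ ≡ true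

  ctx : Form S → List (Form S) → Form S → Form S
  ctx ψ₀ []        χ = ψ₀ ⇒ χ
  ctx ψ₀ (ψ₁ ∷ ψs) χ = ψ₀ ⇒ □ (ctx ψ₁ ψs χ)

  NotFreeIn : Var → Form S → List (Form S) → Set
  NotFreeIn x ψ₀ ψs = All (λ ψ → ¬ Free x ψ) (ψ₀ ∷ ψs)

data Prov (S : Sig) (w : Which) (e : Ext) : Form S → Set where
  taut : ∀ {φ} → Taut φ → Prov S w e φ
  ax-K : ∀ φ ψ → Prov S w e (□ (φ ⇒ ψ) ⇒ (□ φ ⇒ □ ψ))
  ax-T : ∀ φ → Prov S w e (□ φ ⇒ φ)
  ax-4 : ∀ φ → Prov S w e (□ φ ⇒ □ (□ φ))
  ax-2 : ∀ φ → Prov S w e (◇ (□ φ) ⇒ □ (◇ φ))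
  mp   : ∀ {φ ψ} → Prov S w e (φ ⇒ ψ) → Prov S w e φ → Prov S w e ψ
  nec  : ∀ {φ} → Prov S w e φ → Prov S w e (□ φ)
  ax-KwhFS : ∀ x y φ → Adm y x ((B φ) ⇒ φ) →
             Prov S w e (kwh x φ ⇒ sub x y ((B φ) ⇒ φ))
  ax-BBKwh : ∀ x y φ → Adm y x φ →
             Prov S w e (B (sub x y φ) ⇒ B (kwh x φ))
  r-KwhTB : ∀ {x φ ψ₀ ψs} → w ≡ tB → NotFreeIn x ψ₀ ψs →
            Prov S w e (ctx ψ₀ ψs (~ ((B φ) & φ))) →
            Prov S w e (ctx ψ₀ ψs (~ kwh x φ))
  r-FSBKwh : ∀ {x y φ ψ₀ ψs} → w ≡ tB → NotFreeIn x ψ₀ ψs → Adm y x φ →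
             Prov S w e (ctx ψ₀ ψs ((B φ) ⇒ φ)) →
             Prov S w e (ctx ψ₀ ψs (B (sub x y φ) ⇒ kwh x φ))
  r-KwhK : ∀ {x φ ψ₀ ψs} → w ≡ K → NotFreeIn x ψ₀ ψs →
           Prov S w e (ctx ψ₀ ψs (~ (□ φ))) →
           Prov S w e (ctx ψ₀ ψs (~ kwh x φ))
  r-FSKKwh : ∀ {x y φ ψ₀ ψs} → w ≡ K → NotFreeIn x ψ₀ ψs → Adm y x φ →
             Prov S w e (ctx ψ₀ ψs ((B φ) ⇒ φ)) →
             Prov S w e (ctx ψ₀ ψs (□ (sub x y φ) ⇒ kwh x φ))
  ax-refl : ∀ x → Prov S w e (x ≈ x)
  ax-leib : ∀ x y z φ → Adm x z φ → Adm y z φ →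
            Prov S w e ((x ≈ y) ⇒ (sub z x φ ⇒ sub z y φ))
  ax-neq  : ∀ x y → Prov S w e (~ (x ≈ y) ⇒ □ (~ (x ≈ y)))
  r-MONO : ∀ {x φ ψ} → e ≡ mono →
           Prov S w e (φ ⇒ ψ) → Prov S w e (kwh x φ ⇒ kwh x ψ)
  ax-FSneq : ∀ x y φ → e ≡ fsAx →
             Prov S w e (~ (x ≈ y) ⇒ ((B φ) ⇒ φ))

SameTheorems : (S : Sig) → Which → Ext → Ext → Set
SameTheorems S w e₁ e₂ =
  ∀ (φ : Form S) → (Prov S w e₁ φ → Prov S w e₂ φ) × (Prov S w e₂ φ → Prov S w e₁ φ)

-- Each extension derives the extra principle of the other, so derivations translate rule by rule.
-- Write FS χ for [B]χ → χ.
--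
-- From MONO: for fresh z, ¬ x ≈ z is necessary, so FS (x ≈ z) is a theorem and FS&BtoK_wh /
-- FS&KtoK_wh with y := x give ⊢ [K_wh]^z (x ≈ z). MONO weakens this to [K_wh]^z (x ≈ z ∨ θ),
-- whose K_whtoFS instance at y is FS (x ≈ y ∨ θ), i.e. ¬ x ≈ y → FS θ.
--
-- From the FS schema: let ⊢ φ → ψ and v be fresh. Splitting on x ≈ v, ψ implies FS ψ[v/x]; as x is
-- not free there, so does [K_wh]^x φ, and splitting on v ≈ x upgrades this to [K_wh]^x φ → FS ψ.
-- The introduction rule now derives [K_wh]^x ψ under [K_wh]^x φ from the attitude towards ψ, which
-- follows from the (true) attitude towards φ; so the elimination rule refutes
-- [K_wh]^x φ ∧ ¬[K_wh]^x ψ.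
module Submission where

open import Defs
open import Data.Bool using (Bool; true; false; not; _∧_; T)
open import Data.Bool.Properties using (T-∧; T-≡)
open import Data.Empty using (⊥-elim)
open import Data.Fin using (Fin; #_)
open import Data.List using ([])
open import Data.List.Relation.Unary.All using ([]; _∷_)
open import Data.Nat using (ℕ; zero; suc; _⊔_; _<_; _<?_; _≟_)
open import Data.Nat.Properties using (<⇒≢; n<1+n; m⊔n<o⇒m<o; m⊔n<o⇒n<o)
open import Data.Product using (_×_; _,_; proj₁; proj₂)
open import Data.Sum using (inj₁; inj₂)
open import Data.Unit using (tt)
open import Data.Vec using (Vec; []; _∷_; lookup; map; foldr′)
open import Data.Vec.Membership.Propositional using (_∈_)
open import Data.Vec.Properties using (lookup-map)
open import Data.Vec.Relation.Unary.Any using (here; there)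
open import Function using (_∘_)
open import Function.Bundles using (Equivalence)
open import Relation.Nullary using (¬_; yes; no)
open import Relation.Nullary.Decidable using (True)
open import Relation.Binary.PropositionalEquality
  using (_≡_; _≢_; refl; sym; trans; cong; cong₂; subst)

open Equivalence using (to)

-- Deciding propositional tautologies

infixr 4 _⇒ₚ_
infixr 5 _∧ₚ_ _∨ₚ_
infixr 6 ¬ₚ_

data PropForm (n : ℕ) : Set where
  var  : Fin n → PropForm n
  ¬ₚ_  : PropForm n → PropForm n
  _∧ₚ_ : PropForm n → PropForm n → PropForm n

_⇒ₚ_ _∨ₚ_ : ∀ {n} → PropForm n → PropForm n → PropForm n
p ⇒ₚ q = ¬ₚ (p ∧ₚ ¬ₚ q)
p ∨ₚ q = ¬ₚ (¬ₚ p ∧ₚ ¬ₚ q)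

p[_] : ∀ m {n} {m<n : True (m <? n)} → PropForm n
p[ m ] {n} {m<n} = var ((# m) {n} {m<n})

holds : ∀ {n} → Vec Bool n → PropForm n → Bool
holds σ (var i)  = lookup σ i
holds σ (¬ₚ p)   = not (holds σ p)
holds σ (p ∧ₚ q) = holds σ p ∧ holds σ q

forAllAssignments : (n : ℕ) → (Vec Bool n → Bool) → Bool
forAllAssignments zero    f = f []
forAllAssignments (suc n) f =
  forAllAssignments n (f ∘ (true ∷_)) ∧ forAllAssignments n (f ∘ (false ∷_))

forAllAssignments-sound : ∀ n f → T (forAllAssignments n f) → ∀ σ → T (f σ)
forAllAssignments-sound zero    f h []          = h
forAllAssignments-sound (suc n) f h (true ∷ σ)  =
  forAllAssignments-sound n _ (proj₁ (to T-∧ h)) σ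
forAllAssignments-sound (suc n) f h (false ∷ σ) =
  forAllAssignments-sound n _ (proj₂ (to T-∧ h)) σ

valid : ∀ {n} → PropForm n → Bool
valid {n} p = forAllAssignments n (λ σ → holds σ p)

module _ {S : Sig} where

  _[_] : ∀ {n} → PropForm n → Vec (Form S) n → Form S
  var i    [ ρ ] = lookup ρ i
  (¬ₚ p)   [ ρ ] = ~ (p [ ρ ])
  (p ∧ₚ q) [ ρ ] = (p [ ρ ]) & (q [ ρ ])

  eval-[] : ∀ {n} v (p : PropForm n) ρ → eval v (p [ ρ ]) ≡ holds (map (eval v) ρ) p
  eval-[] v (var i)  ρ = sym (lookup-map i (eval v) ρ)
  eval-[] v (¬ₚ p)   ρ = cong not (eval-[] v p ρ)
  eval-[] v (p ∧ₚ q) ρ = cong₂ _∧_ (eval-[] v p ρ) (eval-[] v q ρ)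

  -- The implicit validity proof is left to Agda: T (valid p) normalises to the unit type.
  tautology : ∀ {w e n} (p : PropForm n) (ρ : Vec (Form S) n) {_ : T (valid p)} →
              Prov S w e (p [ ρ ])
  tautology p ρ {p-valid} = taut λ v →
    trans (eval-[] v p ρ) (to T-≡ (forAllAssignments-sound _ _ p-valid (map (eval v) ρ)))

-- Renaming and free variables

module _ {S : Sig} where

  rn-same : ∀ x y → rn {S} x y x ≡ y
  rn-same x y with x ≟ x
  ... | yes _  = refl
  ... | no x≢x = ⊥-elim (x≢x refl)

  rn-diff : ∀ {x} y {v} → v ≢ x → rn {S} x y v ≡ v
  rn-diff {x} y {v} v≢x with v ≟ x
  ... | yes v≡x = ⊥-elim (v≢x v≡x)
  ... | no  _   = refl

  rn-refl : ∀ x v → rn {S} x x v ≡ v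
  rn-refl x v with v ≟ x
  ... | yes v≡x = sym v≡x
  ... | no  _   = refl

  sub-refl : ∀ x (φ : Form S) → sub x x φ ≡ φ
  sub-refl x (atom P ys) = cong (atom P) (map-rn-refl ys)
    where
    map-rn-refl : ∀ {n} (ys : Vec Var n) → map (rn {S} x x) ys ≡ ys
    map-rn-refl []       = refl
    map-rn-refl (v ∷ vs) = cong₂ _∷_ (rn-refl x v) (map-rn-refl vs)
  sub-refl x (u ≈ v)   = cong₂ _≈_ (rn-refl x u) (rn-refl x v)
  sub-refl x (~ φ)     = cong ~_ (sub-refl x φ)
  sub-refl x (φ & ψ)   = cong₂ _&_ (sub-refl x φ) (sub-refl x ψ)
  sub-refl x (□ φ)     = cong □_ (sub-refl x φ)
  sub-refl x (kwh z φ) with z ≟ x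
  ... | yes _ = refl
  ... | no  _ = cong (kwh z) (sub-refl x φ)

  Adm-refl : ∀ x (φ : Form S) → Adm x x φ
  Adm-refl x (atom P ys) = tt
  Adm-refl x (u ≈ v)     = tt
  Adm-refl x (~ φ)       = Adm-refl x φ
  Adm-refl x (φ & ψ)     = Adm-refl x φ , Adm-refl x ψ
  Adm-refl x (□ φ)       = Adm-refl x φ
  Adm-refl x (kwh z φ) with z ≟ x
  ... | yes z≡x = inj₁ λ { (f-kwh x≢z _) → x≢z (sym z≡x) }
  ... | no  z≢x = inj₂ (z≢x , Adm-refl x φ)

  sub-¬Free : ∀ {x} y (φ : Form S) → ¬ Free x φ → sub x y φ ≡ φ
  sub-¬Free y (atom P ys) x∉ = cong (atom P) (map-rn-∉ ys (x∉ ∘ f-atom))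
    where
    map-rn-∉ : ∀ {x n} (ys : Vec Var n) → ¬ x ∈ ys → map (rn {S} x y) ys ≡ ys
    map-rn-∉ []       _  = refl
    map-rn-∉ (v ∷ vs) x∉ =
      cong₂ _∷_ (rn-diff y (x∉ ∘ here ∘ sym)) (map-rn-∉ vs (x∉ ∘ there))
  sub-¬Free y (u ≈ v) x∉ =
    cong₂ _≈_ (rn-diff y (x∉ ∘ f-eql ∘ inj₁ ∘ sym)) (rn-diff y (x∉ ∘ f-eql ∘ inj₂ ∘ sym))
  sub-¬Free y (~ φ)   x∉ = cong ~_ (sub-¬Free y φ (x∉ ∘ f-neg))
  sub-¬Free y (φ & ψ) x∉ = cong₂ _&_ (sub-¬Free y φ (x∉ ∘ f-andl)) (sub-¬Free y ψ (x∉ ∘ f-andr))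
  sub-¬Free y (□ φ)   x∉ = cong □_ (sub-¬Free y φ (x∉ ∘ f-box))
  sub-¬Free {x} y (kwh z φ) x∉ with z ≟ x
  ... | yes _   = refl
  ... | no  z≢x = cong (kwh z) (sub-¬Free y φ (x∉ ∘ f-kwh (z≢x ∘ sym)))

  Adm-¬Free : ∀ {x} y (φ : Form S) → ¬ Free x φ → Adm y x φ
  Adm-¬Free y (atom P ys) _  = tt
  Adm-¬Free y (u ≈ v)     _  = tt
  Adm-¬Free y (~ φ)       x∉ = Adm-¬Free y φ (x∉ ∘ f-neg)
  Adm-¬Free y (φ & ψ)     x∉ = Adm-¬Free y φ (x∉ ∘ f-andl) , Adm-¬Free y ψ (x∉ ∘ f-andr)
  Adm-¬Free y (□ φ)       x∉ = Adm-¬Free y φ (x∉ ∘ f-box)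
  Adm-¬Free y (kwh z φ)   x∉ = inj₁ x∉

  rn-≢ : ∀ {x v} u → v ≢ x → rn {S} x v u ≢ x
  rn-≢ {x} u v≢x with u ≟ x
  ... | yes _   = v≢x
  ... | no  u≢x = u≢x

  ¬Free-sub : ∀ {x v} (φ : Form S) → v ≢ x → ¬ Free x (sub x v φ)
  ¬Free-sub {x} {v} (atom P ys) v≢x (f-atom x∈) = ∉-map-rn ys x∈
    where
    ∉-map-rn : ∀ {n} (ys : Vec Var n) → ¬ x ∈ map (rn {S} x v) ys
    ∉-map-rn (u ∷ us) (here x≡)   = rn-≢ u v≢x (sym x≡)
    ∉-map-rn (u ∷ us) (there x∈) = ∉-map-rn us x∈
  ¬Free-sub (u ≈ u′) v≢x (f-eql (inj₁ x≡)) = rn-≢ u  v≢x (sym x≡)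
  ¬Free-sub (u ≈ u′) v≢x (f-eql (inj₂ x≡)) = rn-≢ u′ v≢x (sym x≡)
  ¬Free-sub (~ φ)   v≢x (f-neg f)  = ¬Free-sub φ v≢x f
  ¬Free-sub (φ & ψ) v≢x (f-andl f) = ¬Free-sub φ v≢x f
  ¬Free-sub (φ & ψ) v≢x (f-andr f) = ¬Free-sub ψ v≢x f
  ¬Free-sub (□ φ)   v≢x (f-box f)  = ¬Free-sub φ v≢x f
  ¬Free-sub {x} (kwh z φ) v≢x f with z ≟ x
  ¬Free-sub (kwh z φ) v≢x (f-kwh x≢z _) | yes z≡x = x≢z (sym z≡x)
  ¬Free-sub (kwh z φ) v≢x (f-kwh _ f)   | no  _   = ¬Free-sub φ v≢x f

  varMax : Form S → Var
  varMax (atom P ys) = foldr′ _⊔_ 0 ys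
  varMax (u ≈ v)     = u ⊔ v
  varMax (~ φ)       = varMax φ
  varMax (φ & ψ)     = varMax φ ⊔ varMax ψ
  varMax (□ φ)       = varMax φ
  varMax (kwh z φ)   = z ⊔ varMax φ

  ¬Free-above : ∀ {v} (φ : Form S) → varMax φ < v → ¬ Free v φ
  ¬Free-above (atom P ys) φ<v (f-atom v∈) = ∉-above ys φ<v v∈
    where
    ∉-above : ∀ {v n} (ys : Vec Var n) → foldr′ _⊔_ 0 ys < v → ¬ v ∈ ys
    ∉-above (u ∷ us) ys<v (here refl)  = <⇒≢ (m⊔n<o⇒m<o u _ ys<v) refl
    ∉-above (u ∷ us) ys<v (there v∈)   = ∉-above us (m⊔n<o⇒n<o u _ ys<v) v∈
  ¬Free-above (u ≈ u′) φ<v (f-eql (inj₁ refl)) = <⇒≢ (m⊔n<o⇒m<o u u′ φ<v) refl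
  ¬Free-above (u ≈ u′) φ<v (f-eql (inj₂ refl)) = <⇒≢ (m⊔n<o⇒n<o u u′ φ<v) refl
  ¬Free-above (~ φ)     φ<v (f-neg f)   = ¬Free-above φ φ<v f
  ¬Free-above (φ & ψ)   φ<v (f-andl f)  = ¬Free-above φ (m⊔n<o⇒m<o _ _ φ<v) f
  ¬Free-above (φ & ψ)   φ<v (f-andr f)  = ¬Free-above ψ (m⊔n<o⇒n<o _ _ φ<v) f
  ¬Free-above (□ φ)     φ<v (f-box f)   = ¬Free-above φ φ<v f
  ¬Free-above (kwh z φ) φ<v (f-kwh _ f) = ¬Free-above φ (m⊔n<o⇒n<o z _ φ<v) f

  Adm-above : ∀ {v} x (φ : Form S) → varMax φ < v → Adm v x φ
  Adm-above x (atom P ys) _   = tt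
  Adm-above x (u ≈ u′)    _   = tt
  Adm-above x (~ φ)       φ<v = Adm-above x φ φ<v
  Adm-above x (φ & ψ)     φ<v = Adm-above x φ (m⊔n<o⇒m<o _ _ φ<v) , Adm-above x ψ (m⊔n<o⇒n<o _ _ φ<v)
  Adm-above x (□ φ)       φ<v = Adm-above x φ φ<v
  Adm-above x (kwh z φ)   φ<v =
    inj₂ (<⇒≢ (m⊔n<o⇒m<o z _ φ<v) , Adm-above x φ (m⊔n<o⇒n<o z _ φ<v))

  fresh : Var → Form S → Var
  fresh x φ = suc (x ⊔ varMax φ)

  fresh-≢ : ∀ x φ → fresh x φ ≢ x
  fresh-≢ x φ v≡x = <⇒≢ (m⊔n<o⇒m<o x _ (n<1+n _)) (sym v≡x)

  fresh-¬Free : ∀ x φ → ¬ Free (fresh x φ) φ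
  fresh-¬Free x φ = ¬Free-above φ (m⊔n<o⇒n<o x _ (n<1+n _))

  fresh-Adm : ∀ x y φ → Adm (fresh x φ) y φ
  fresh-Adm x y φ = Adm-above y φ (m⊔n<o⇒n<o x _ (n<1+n _))

module _ {S : Sig} where

  infixr 5 _∨_

  _∨_ : Form S → Form S → Form S
  φ ∨ ψ = ~ (~ φ & ~ ψ)

  FS : Form S → Form S
  FS φ = B φ ⇒ φ

  ¬Free-FS : ∀ {x} {φ : Form S} → ¬ Free x φ → ¬ Free x (FS φ)
  ¬Free-FS x∉ (f-neg (f-andl (f-neg (f-box (f-neg (f-box f)))))) = x∉ f
  ¬Free-FS x∉ (f-neg (f-andr (f-neg f)))                         = x∉ f

  -- TrueAttitude is the modality refuted in K_whtoTB / K_whtoK ([tB]φ = [B]φ ∧ φ, resp. [K]φ),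
  -- Attitude the one assumed in FS&BtoK_wh / FS&KtoK_wh.
  TrueAttitude Attitude : Which → Form S → Form S
  TrueAttitude tB φ = B φ & φ
  TrueAttitude K  φ = □ φ
  Attitude tB φ = B φ
  Attitude K  φ = □ φ

  module _ {e : Ext} where

    infix 3 _⊢_

    _⊢_ : Which → Form S → Set
    w ⊢ φ = Prov S w e φ

    ⇒-trans : ∀ {w φ ψ χ} → w ⊢ φ ⇒ ψ → w ⊢ ψ ⇒ χ → w ⊢ φ ⇒ χ
    ⇒-trans {φ = φ} {ψ} {χ} φ⇒ψ ψ⇒χ =
      mp (mp (tautology ((p[ 0 ] ⇒ₚ p[ 1 ]) ⇒ₚ (p[ 1 ] ⇒ₚ p[ 2 ]) ⇒ₚ p[ 0 ] ⇒ₚ p[ 2 ]) (φ ∷ ψ ∷ χ ∷ []))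
             φ⇒ψ) ψ⇒χ

    contraposition : ∀ {w φ ψ} → w ⊢ φ ⇒ ψ → w ⊢ ~ ψ ⇒ ~ φ
    contraposition {φ = φ} {ψ} =
      mp (tautology ((p[ 0 ] ⇒ₚ p[ 1 ]) ⇒ₚ ¬ₚ p[ 1 ] ⇒ₚ ¬ₚ p[ 0 ]) (φ ∷ ψ ∷ []))

    □-mono : ∀ {w φ ψ} → w ⊢ φ ⇒ ψ → w ⊢ □ φ ⇒ □ ψ
    □-mono {φ = φ} {ψ} φ⇒ψ = mp (ax-K φ ψ) (nec φ⇒ψ)

    B-mono : ∀ {w φ ψ} → w ⊢ φ ⇒ ψ → w ⊢ B φ ⇒ B ψ
    B-mono = contraposition ∘ □-mono ∘ contraposition ∘ □-mono

    B-nec : ∀ {w φ} → w ⊢ φ → w ⊢ B φ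
    B-nec {φ = φ} ⊢φ =
      mp (mp (tautology (p[ 0 ] ⇒ₚ (p[ 1 ] ⇒ₚ ¬ₚ p[ 0 ]) ⇒ₚ ¬ₚ p[ 1 ]) (□ φ ∷ □ ~ □ φ ∷ []))
             (nec ⊢φ)) (ax-T (~ □ φ))

    FS-≈ : ∀ {w} x y → w ⊢ FS (x ≈ y)
    FS-≈ x y =
      mp (tautology ((¬ₚ p[ 0 ] ⇒ₚ p[ 1 ]) ⇒ₚ ¬ₚ p[ 1 ] ⇒ₚ p[ 0 ]) (x ≈ y ∷ □ ~ □ (x ≈ y) ∷ []))
         (⇒-trans (ax-neq x y) (□-mono (contraposition (ax-T (x ≈ y)))))

    TrueAttitude-elim : ∀ {w} φ → w ⊢ TrueAttitude w φ ⇒ φ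
    TrueAttitude-elim {tB} φ = tautology (p[ 0 ] ∧ₚ p[ 1 ] ⇒ₚ p[ 1 ]) (B φ ∷ φ ∷ [])
    TrueAttitude-elim {K}  φ = ax-T φ

    TrueAttitude⇒Attitude : ∀ {w φ ψ} → w ⊢ φ ⇒ ψ → w ⊢ TrueAttitude w φ ⇒ Attitude w ψ
    TrueAttitude⇒Attitude {tB} φ⇒ψ =
      ⇒-trans (tautology (p[ 0 ] ∧ₚ p[ 1 ] ⇒ₚ p[ 0 ]) (B _ ∷ _ ∷ [])) (B-mono φ⇒ψ)
    TrueAttitude⇒Attitude {K}  φ⇒ψ = □-mono φ⇒ψ

    Attitude-nec : ∀ {w φ} → w ⊢ φ → w ⊢ Attitude w φ
    Attitude-nec {tB} = B-nec
    Attitude-nec {K}  = nec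

    refute-kwh : ∀ {w x φ ψ₀} → ¬ Free x ψ₀ →
                 w ⊢ ψ₀ ⇒ ~ TrueAttitude w φ → w ⊢ ψ₀ ⇒ ~ kwh x φ
    refute-kwh {tB} {x} {φ} {ψ₀} x∉ψ₀ = r-KwhTB {x = x} {φ} {ψ₀} {[]} refl (x∉ψ₀ ∷ [])
    refute-kwh {K}  {x} {φ} {ψ₀} x∉ψ₀ = r-KwhK  {x = x} {φ} {ψ₀} {[]} refl (x∉ψ₀ ∷ [])

    establish-kwh : ∀ {w x y φ ψ₀} → ¬ Free x ψ₀ → Adm y x φ →
                    w ⊢ ψ₀ ⇒ FS φ → w ⊢ ψ₀ ⇒ (Attitude w (sub x y φ) ⇒ kwh x φ)
    establish-kwh {tB} {x} {y} {φ} {ψ₀} x∉ψ₀ = r-FSBKwh {x = x} {y} {φ} {ψ₀} {[]} refl (x∉ψ₀ ∷ [])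
    establish-kwh {K}  {x} {y} {φ} {ψ₀} x∉ψ₀ = r-FSKKwh {x = x} {y} {φ} {ψ₀} {[]} refl (x∉ψ₀ ∷ [])

    ⇒-const : ∀ {w φ} ψ → w ⊢ φ → w ⊢ ψ ⇒ φ
    ⇒-const {φ = φ} ψ = mp (tautology (p[ 0 ] ⇒ₚ p[ 1 ] ⇒ₚ p[ 0 ]) (φ ∷ ψ ∷ []))

    kwh-elim : ∀ {w x φ θ} → ¬ Free x θ → w ⊢ φ ⇒ θ → w ⊢ kwh x φ ⇒ θ
    kwh-elim {x = x} {φ} {θ} x∉θ φ⇒θ =
      mp (tautology ((¬ₚ p[ 0 ] ⇒ₚ ¬ₚ p[ 1 ]) ⇒ₚ p[ 1 ] ⇒ₚ p[ 0 ]) (θ ∷ kwh x φ ∷ []))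
         (refute-kwh (λ { (f-neg f) → x∉θ f })
                     (contraposition (⇒-trans (TrueAttitude-elim φ) φ⇒θ)))

    kwh-identity : ∀ {w x z} → z ≢ x → w ⊢ kwh z (x ≈ z)
    kwh-identity {w} {x} {z} z≢x =
      mp (mp (subst (λ χ → w ⊢ x ≈ x ⇒ (Attitude w χ ⇒ kwh z (x ≈ z))) sub-x≈z
                    (establish-kwh z∉x≈x tt (⇒-const (x ≈ x) (FS-≈ x z))))
             (ax-refl x))
         (Attitude-nec (ax-refl x))
      where
      z∉x≈x : ¬ Free z (x ≈ x)
      z∉x≈x (f-eql (inj₁ z≡x)) = z≢x z≡x
      z∉x≈x (f-eql (inj₂ z≡x)) = z≢x z≡x
      sub-x≈z : sub z x (x ≈ z) ≡ x ≈ x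
      sub-x≈z = cong₂ _≈_ (rn-diff {S} x (z≢x ∘ sym)) (rn-same {S} z x)

    MONO-Rule FS-Schema : Which → Set
    MONO-Rule w = ∀ {x φ ψ} → w ⊢ φ ⇒ ψ → w ⊢ kwh x φ ⇒ kwh x ψ
    FS-Schema w = ∀ x y φ → w ⊢ ~ x ≈ y ⇒ FS φ

    FS-from-MONO : ∀ {w} → MONO-Rule w → FS-Schema w
    FS-from-MONO {w} MONO x y θ =
      mp (mp (tautology ((p[ 0 ] ⇒ₚ p[ 1 ]) ⇒ₚ (p[ 1 ] ⇒ₚ p[ 2 ] ∨ₚ p[ 3 ]) ⇒ₚ
                         ¬ₚ p[ 2 ] ⇒ₚ p[ 0 ] ⇒ₚ p[ 3 ])
                        (B θ ∷ B (x ≈ y ∨ θ) ∷ x ≈ y ∷ θ ∷ []))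
             (B-mono (∨-introʳ (x ≈ y) θ)))
         (mp kwh-instance (mp (MONO (∨-introˡ (x ≈ z) θ)) (kwh-identity (fresh-≢ x θ))))
      where
      z = fresh x θ
      z∉θ = fresh-¬Free x θ
      ∨-introˡ : ∀ φ ψ → w ⊢ φ ⇒ φ ∨ ψ
      ∨-introʳ : ∀ φ ψ → w ⊢ ψ ⇒ φ ∨ ψ
      ∨-introˡ φ ψ = tautology (p[ 0 ] ⇒ₚ p[ 0 ] ∨ₚ p[ 1 ]) (φ ∷ ψ ∷ [])
      ∨-introʳ φ ψ = tautology (p[ 1 ] ⇒ₚ p[ 0 ] ∨ₚ p[ 1 ]) (φ ∷ ψ ∷ [])
      sub-z : sub z y (x ≈ z ∨ θ) ≡ x ≈ y ∨ θ
      sub-z = cong₂ _∨_ (cong₂ _≈_ (rn-diff {S} y (fresh-≢ x θ ∘ sym)) (rn-same {S} z y))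
                        (sub-¬Free y θ z∉θ)
      kwh-instance : w ⊢ kwh z (x ≈ z ∨ θ) ⇒ FS (x ≈ y ∨ θ)
      kwh-instance = subst (λ χ → w ⊢ kwh z (x ≈ z ∨ θ) ⇒ FS χ) sub-z
                       (ax-KwhFS z y _ (adm , adm))
        where adm = tt , Adm-¬Free y θ z∉θ

    module _ {w : Which} (fs : FS-Schema w) {x v : Var} {ψ : Form S} (adm : Adm v x ψ) where

      ⇒-FS-sub : w ⊢ ψ ⇒ FS (sub x v ψ)
      ⇒-FS-sub =
        mp (mp (tautology ((p[ 0 ] ⇒ₚ p[ 1 ] ⇒ₚ p[ 2 ]) ⇒ₚ (¬ₚ p[ 0 ] ⇒ₚ p[ 3 ] ⇒ₚ p[ 2 ]) ⇒ₚ
                           p[ 1 ] ⇒ₚ p[ 3 ] ⇒ₚ p[ 2 ])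
                          (x ≈ v ∷ ψ ∷ sub x v ψ ∷ B (sub x v ψ) ∷ []))
               (subst (λ χ → w ⊢ x ≈ v ⇒ (χ ⇒ sub x v ψ)) (sub-refl x ψ)
                      (ax-leib x v x ψ (Adm-refl x ψ) adm)))
           (fs x v (sub x v ψ))

      FS-sub⇒FS : ∀ {χ} → w ⊢ χ ⇒ FS (sub x v ψ) → w ⊢ χ ⇒ FS ψ
      FS-sub⇒FS {χ} χ⇒FS-sub =
        mp (mp (mp (tautology ((p[ 0 ] ⇒ₚ p[ 1 ]) ⇒ₚ (p[ 2 ] ⇒ₚ p[ 1 ] ⇒ₚ p[ 3 ]) ⇒ₚ (¬ₚ p[ 2 ] ⇒ₚ p[ 3 ]) ⇒ₚ
                               p[ 0 ] ⇒ₚ p[ 3 ])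
                              (χ ∷ FS (sub x v ψ) ∷ v ≈ x ∷ FS ψ ∷ []))
                   χ⇒FS-sub)
               (subst (λ ξ → w ⊢ v ≈ x ⇒ (FS (sub x v ψ) ⇒ ξ)) (sub-refl x (FS ψ))
                      (ax-leib v x x (FS ψ) (adm , adm) (Adm-refl x (FS ψ)))))
           (fs v x ψ)

    MONO-from-FS : ∀ {w} → FS-Schema w → MONO-Rule w
    MONO-from-FS {w} fs {x} {φ} {ψ} φ⇒ψ =
      mp (tautology ((p[ 0 ] ∧ₚ ¬ₚ p[ 1 ] ⇒ₚ ¬ₚ p[ 0 ]) ⇒ₚ p[ 0 ] ⇒ₚ p[ 1 ]) (kwh x φ ∷ kwh x ψ ∷ []))
         (refute-kwh x∉context
           (mp (mp (tautology ((p[ 0 ] ⇒ₚ p[ 2 ] ⇒ₚ p[ 1 ]) ⇒ₚ (p[ 3 ] ⇒ₚ p[ 2 ]) ⇒ₚ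
                               p[ 0 ] ∧ₚ ¬ₚ p[ 1 ] ⇒ₚ ¬ₚ p[ 3 ])
                              (kwh x φ ∷ kwh x ψ ∷ Attitude w ψ ∷ TrueAttitude w φ ∷ []))
                   kwhφ⇒attitude⇒kwhψ)
               (TrueAttitude⇒Attitude φ⇒ψ)))
      where
      v = fresh x ψ
      adm : Adm v x ψ
      adm = fresh-Adm x x ψ
      x∉kwhφ : ¬ Free x (kwh x φ)
      x∉kwhφ (f-kwh x≢x _) = x≢x refl
      x∉context : ¬ Free x (kwh x φ & ~ kwh x ψ)
      x∉context (f-andl (f-kwh x≢x _))         = x≢x refl
      x∉context (f-andr (f-neg (f-kwh x≢x _))) = x≢x refl
      kwhφ⇒FSψ : w ⊢ kwh x φ ⇒ FS ψ
      kwhφ⇒FSψ = FS-sub⇒FS fs adm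
                   (kwh-elim (¬Free-FS (¬Free-sub ψ (fresh-≢ x ψ))) (⇒-trans φ⇒ψ (⇒-FS-sub fs adm)))
      kwhφ⇒attitude⇒kwhψ : w ⊢ kwh x φ ⇒ (Attitude w ψ ⇒ kwh x ψ)
      kwhφ⇒attitude⇒kwhψ = subst (λ χ → w ⊢ kwh x φ ⇒ (Attitude w χ ⇒ kwh x ψ)) (sub-refl x ψ)
                             (establish-kwh x∉kwhφ (Adm-refl x ψ) kwhφ⇒FSψ)

transfer : ∀ {S w e₁ e₂} →
           (e₁ ≡ mono → MONO-Rule {S} {e₂} w) → (e₁ ≡ fsAx → FS-Schema {S} {e₂} w) →
           ∀ {φ} → Prov S w e₁ φ → Prov S w e₂ φ
transfer MONO fs = go
  where
  go : ∀ {φ} → Prov _ _ _ φ → Prov _ _ _ φ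
  go (taut t)                = taut t
  go (ax-K φ ψ)              = ax-K φ ψ
  go (ax-T φ)                = ax-T φ
  go (ax-4 φ)                = ax-4 φ
  go (ax-2 φ)                = ax-2 φ
  go (mp p q)                = mp (go p) (go q)
  go (nec p)                 = nec (go p)
  go (ax-KwhFS x y φ a)      = ax-KwhFS x y φ a
  go (ax-BBKwh x y φ a)      = ax-BBKwh x y φ a
  go (r-KwhTB {x} {φ} {ψ₀} {ψs} w≡ nf p) = r-KwhTB {x = x} {φ} {ψ₀} {ψs} w≡ nf (go p)
  go (r-FSBKwh {x} {y} {φ} {ψ₀} {ψs} w≡ nf a p) = r-FSBKwh {x = x} {y} {φ} {ψ₀} {ψs} w≡ nf a (go p)
  go (r-KwhK {x} {φ} {ψ₀} {ψs} w≡ nf p) = r-KwhK {x = x} {φ} {ψ₀} {ψs} w≡ nf (go p)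
  go (r-FSKKwh {x} {y} {φ} {ψ₀} {ψs} w≡ nf a p) = r-FSKKwh {x = x} {y} {φ} {ψ₀} {ψs} w≡ nf a (go p)
  go (ax-refl x)             = ax-refl x
  go (ax-leib x y z φ a b)   = ax-leib x y z φ a b
  go (ax-neq x y)            = ax-neq x y
  go (r-MONO e≡ p)           = MONO e≡ (go p)
  go (ax-FSneq x y φ e≡)     = fs e≡ x y φ

mono⇔fsAx : ∀ S w → SameTheorems S w mono fsAx
mono⇔fsAx S w _ =
  transfer (λ _ → MONO-from-FS (λ x y φ → ax-FSneq x y φ refl)) (λ ()) ,
  transfer (λ ()) (λ _ → FS-from-MONO (r-MONO refl))

proposition4 : ∀ (S : Sig) →
    SameTheorems S tB mono fsAx × SameTheorems S K mono fsAx
proposition4 S = mono⇔fsAx S tB , mono⇔fsAx S K
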